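{- Let $H$ be a balanced complete bipartite graph whose edges are coloured red and blue. Then either (a) $H$ is spanned by two vertex-disjoint monochromatic connected matchings, one red and one blue, or (b) the colouring is split, and $H$ is spanned by one red and two blue vertex-disjoint monochromatic connected matchings, and also $H$ is spanned by one blue and two red vertex-disjoint monochromatic connected matchings.
   Context: A bipartite graph is trivial if one of its biparts has no vertices. A monochromatic component of colour $c$ is a connected component of the spanning subgraph formed by the edges of colour $c$. A monochromatic connected matching is a matching whose edges all have one colour $c$ and which lies in a single monochromatic component of colour $c$ (empty matchings allowed). A collection of subgraphs spans $H$ if the union of their vertex sets is $V(H)$. The colouring is split if all monochromatic components are non-trivial and each colour has exactly two monochromatic components. -}

module Defs where

open import Data.Nat using (ℕ)
open import Data.Fin using (Fin)
open import Data.Sum using (_⊎_; inj₁; inj₂)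
open import Data.Product using (_×_; _,_; proj₁; proj₂; ∃)
open import Data.List using (List; map)
open import Data.List.Membership.Propositional using (_∈_)
open import Data.List.Relation.Unary.All using (All)
open import Data.List.Relation.Unary.Unique.Propositional using (Unique)
open import Data.Empty using (⊥)
open import Relation.Nullary using (¬_)
open import Relation.Binary.PropositionalEquality using (_≡_)
open import Relation.Binary.Construct.Closure.ReflexiveTransitive using (Star)

data Colour : Set where
  red blue : Colour

-- The balanced complete bipartite graph K_{n,n}: vertices are the left part
-- (inj₁ i) and the right part (inj₂ j), i j : Fin n; every pair (i , j)
-- is an edge.
Vertex : ℕ → Set
Vertex n = Fin n ⊎ Fin n

Edge : ℕ → Set
Edge n = Fin n × Fin n   -- (left endpoint , right endpoint)

Colouring : ℕ → Set
Colouring n = Fin n → Fin n → Colour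

data Adj {n : ℕ} (χ : Colouring n) (c : Colour) : Vertex n → Vertex n → Set where
  lr : ∀ {i j} → χ i j ≡ c → Adj χ c (inj₁ i) (inj₂ j)
  rl : ∀ {i j} → χ i j ≡ c → Adj χ c (inj₂ j) (inj₁ i)

Reach : {n : ℕ} → Colouring n → Colour → Vertex n → Vertex n → Set
Reach χ c = Star (Adj χ c)

IsMatching : {n : ℕ} → List (Edge n) → Set
IsMatching M = Unique (map proj₁ M) × Unique (map proj₂ M)

-- Monochromatic connected matching of colour c: a matching, all edges of
-- colour c, all lying in a single monochromatic component of colour c
-- (the empty matching is allowed).
MonoConnMatching : {n : ℕ} → Colouring n → Colour → List (Edge n) → Set
MonoConnMatching χ c M =
  IsMatching M
  × All (λ e → χ (proj₁ e) (proj₂ e) ≡ c) M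
  × (∀ {e e'} → e ∈ M → e' ∈ M → Reach χ c (inj₁ (proj₁ e)) (inj₁ (proj₁ e')))

InV : {n : ℕ} → List (Edge n) → Vertex n → Set
InV M (inj₁ i) = ∃ λ j → (i , j) ∈ M
InV M (inj₂ j) = ∃ λ i → (i , j) ∈ M

VDisjoint : {n : ℕ} → List (Edge n) → List (Edge n) → Set
VDisjoint M M' = ∀ v → InV M v → InV M' v → ⊥

NonTrivialComp : {n : ℕ} → Colouring n → Colour → Vertex n → Set
NonTrivialComp χ c w = (∃ λ i → Reach χ c w (inj₁ i)) × (∃ λ j → Reach χ c w (inj₂ j))

ExactlyTwoComps : {n : ℕ} → Colouring n → Colour → Set
ExactlyTwoComps {n} χ c =
  ∃ λ (u : Vertex n) → ∃ λ (v : Vertex n) →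
    ¬ Reach χ c u v × (∀ w → Reach χ c u w ⊎ Reach χ c v w)

Split : {n : ℕ} → Colouring n → Set
Split χ = (∀ c w → NonTrivialComp χ c w) × (∀ c → ExactlyTwoComps χ c)

Span2 : {n : ℕ} → Colouring n → Colour → Colour → Set
Span2 {n} χ c d =
  ∃ λ (M₁ : List (Edge n)) → ∃ λ (M₂ : List (Edge n)) →
    MonoConnMatching χ c M₁ × MonoConnMatching χ d M₂
    × VDisjoint M₁ M₂
    × (∀ v → InV M₁ v ⊎ InV M₂ v)

Span3 : {n : ℕ} → Colouring n → Colour → Colour → Set
Span3 {n} χ c d =
  ∃ λ (M₁ : List (Edge n)) → ∃ λ (M₂ : List (Edge n)) → ∃ λ (M₃ : List (Edge n)) →
    MonoConnMatching χ c M₁ × MonoConnMatching χ d M₂ × MonoConnMatching χ d M₃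
    × VDisjoint M₁ M₂ × VDisjoint M₁ M₃ × VDisjoint M₂ M₃
    × (∀ v → InV M₁ v ⊎ InV M₂ v ⊎ InV M₃ v)

-- Fix a left vertex u.  If the red component of u contains the whole right
-- side, it contains every red edge, so the red edges of any perfect matching
-- form a connected matching; it remains to find a perfect matching whose blue
-- edges are connected, which is done by induction on n, re-routing the two new
-- vertices through a transposition when needed.  The same applies with the
-- colours exchanged.  Otherwise some right vertex v₁ is not red-reachable and
-- some v₂ is not blue-reachable from u.  Every edge from the red component of
-- u to v₁ is blue and every edge from its blue component to v₂ is red, so the
-- two components have the same left part.  If that is the whole left side, any
-- perfect matching works.  If not, the red edges are exactly those inside the
-- red component R of u or inside its complement, so the colouring is split; a
-- perfect matching with connected red edges then has its blue edges inside the
-- two blue components, which gives the three matchings.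

module Submission where

open import Defs

open import Data.Bool using (Bool; true; false; not)
import Data.Bool as Bool
open import Data.Bool.Properties using (not-¬; ¬-not; not-involutive)
open import Data.Empty using (⊥; ⊥-elim)
open import Data.Fin using (Fin; zero; suc; _≟_)
open import Data.Fin.Permutation
  using (Permutation′; _⟨$⟩ʳ_; _⟨$⟩ˡ_; inverseˡ; inverseʳ; lift₀; transpose; _∘ₚ_)
  renaming (id to idₚ)
import Data.Fin.Permutation.Components as PC
open import Data.Fin.Properties using (all?; any?; ¬∀⟶∃¬; ¬Fin0; suc-injective)
open import Data.List using (List; length; map; filter; allFin; _++_)
open import Data.List.Membership.Propositional using (_∈_; lose)
open import Data.List.Membership.Propositional.Properties
  using (∈-map⁺; ∈-map⁻; ∈-filter⁺; ∈-filter⁻; ∈-allFin; ∈-++⁺ˡ; ∈-++⁺ʳ)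
open import Data.List.Properties using (length-filter; map-∘)
open import Data.List.Relation.Binary.Pointwise using (Pointwise-≡⇒≡)
open import Data.List.Relation.Binary.Sublist.Propositional using (_⊆_; ⊆-refl)
open import Data.List.Relation.Binary.Sublist.Propositional.Properties
  using (filter⁺; to-≋; length-mono-≤)
open import Data.List.Relation.Unary.All using (tabulate)
open import Data.List.Relation.Unary.Any as Any using (Any; satisfied)
open import Data.List.Relation.Unary.Unique.Propositional using (Unique)
open import Data.List.Relation.Unary.Unique.Propositional.Properties
  using (allFin⁺) renaming (map⁺ to Unique-map⁺; filter⁺ to Unique-filter⁺)
open import Data.Nat using (ℕ; zero; suc; _≤_; z≤n)
import Data.Nat.Properties as ℕ
open import Data.Product using (_×_; _,_; proj₁; proj₂; map₂; ∃; Σ)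
open import Data.Sum using (_⊎_; inj₁; inj₂)
import Data.Sum as Sum
open import Data.Sum.Properties using (≡-dec)
open import Function using (_∘_; id; mk⇔)
open import Level using (0ℓ)
open import Relation.Binary using (Rel; DecidableEquality)
import Relation.Binary as Binary
open import Relation.Binary.Construct.Closure.ReflexiveTransitive
  using (Star; ε; _◅_; _◅◅_; gmap; reverse)
open import Relation.Binary.PropositionalEquality
  using (_≡_; _≢_; refl; sym; trans; cong; subst)
open import Relation.Nullary using (¬_; Dec; yes; no; does; contradiction)
open import Relation.Nullary.Decidable
  using (map′; _⊎-dec_; _×-dec_; dec-true; dec-false; does-⇔)
open import Relation.Unary using (Pred; Decidable)

does-≡⇒both-or-neither : ∀ {A B : Set} (a? : Dec A) (b? : Dec B) →
  does a? ≡ does b? → (A × B) ⊎ (¬ A × ¬ B)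
does-≡⇒both-or-neither (yes a) (yes b) _ = inj₁ (a , b)
does-≡⇒both-or-neither (no ¬a) (no ¬b) _ = inj₂ (¬a , ¬b)

∀-or-∃¬ : ∀ {n} {P : Pred (Fin n) 0ℓ} → Decidable P → (∀ i → P i) ⊎ ∃ λ i → ¬ P i
∀-or-∃¬ {n} {P} P? with all? P?
... | yes all = inj₁ all
... | no ¬all = inj₂ (¬∀⟶∃¬ n P P? ¬all)

-- Decidability of reachability in a finite graph

bounded-monotone⇒plateau : (s : ℕ → ℕ) {N : ℕ} →
  (∀ k → s k ≤ s (suc k)) → (∀ k → s k ≤ N) → ∃ λ k → s (suc k) ≡ s k
bounded-monotone⇒plateau s {N} mono bound with climb (suc N)
  where
  climb : ∀ k → (∃ λ k → s (suc k) ≡ s k) ⊎ k ≤ s k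
  climb zero = inj₂ z≤n
  climb (suc k) with climb k
  ... | inj₁ plateau = inj₁ plateau
  ... | inj₂ k≤sk with s (suc k) ℕ.≟ s k
  ...   | yes eq = inj₁ (k , eq)
  ...   | no neq = inj₂ (ℕ.≤-<-trans k≤sk (ℕ.≤∧≢⇒< (mono k) (neq ∘ sym)))
... | inj₁ plateau = plateau
... | inj₂ N<s = contradiction (ℕ.≤-trans N<s (bound (suc N))) ℕ.1+n≰n

module FiniteReachability {A : Set} (_≟ᴬ_ : DecidableEquality A)
  {xs : List A} (∈xs : ∀ x → x ∈ xs) {E : Rel A 0ℓ} (E? : Binary.Decidable E) (a : A) where

  Within : ℕ → Pred A 0ℓ
  Within zero x = x ≡ a
  Within (suc k) x = Within k x ⊎ Any (λ y → Within k y × E y x) xs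

  within? : ∀ k → Decidable (Within k)
  within? zero x = x ≟ᴬ a
  within? (suc k) x = within? k x ⊎-dec Any.any? (λ y → within? k y ×-dec E? y x) xs

  within⇒star : ∀ k {x} → Within k x → Star E a x
  within⇒star zero refl = ε
  within⇒star (suc k) (inj₁ w) = within⇒star k w
  within⇒star (suc k) (inj₂ p) with _ , w , e ← satisfied p = within⇒star k w ◅◅ (e ◅ ε)

  within-start : ∀ k → Within k a
  within-start zero = refl
  within-start (suc k) = inj₁ (within-start k)

  ball : ℕ → List A
  ball k = filter (within? k) xs

  ball⊆ball-suc : ∀ k → ball k ⊆ ball (suc k)
  ball⊆ball-suc k = filter⁺ (within? k) (within? (suc k)) (λ { refl → inj₁ }) (⊆-refl {x = xs})

  -- A sublist of the same length is the whole list.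
  plateau⇒closed : ∀ k → length (ball (suc k)) ≡ length (ball k) →
                   ∀ {x} → Within (suc k) x → Within k x
  plateau⇒closed k eq {x} w = proj₂ (∈-filter⁻ (within? k) {xs = xs} x∈ball)
    where
    x∈ball : x ∈ ball k
    x∈ball = subst (x ∈_) (sym (Pointwise-≡⇒≡ (to-≋ (sym eq) (ball⊆ball-suc k))))
                   (∈-filter⁺ (within? (suc k)) (∈xs x) w)

  closed⇒within : ∀ k → (∀ {x} → Within (suc k) x → Within k x) →
                  ∀ {x y} → Within k x → Star E x y → Within k y
  closed⇒within k closed w ε = w
  closed⇒within k closed {x} w (e ◅ p) =
    closed⇒within k closed (closed (inj₂ (lose (∈xs x) (w , e)))) p

  star? : ∀ b → Dec (Star E a b)
  star? b with k , eq ← bounded-monotone⇒plateau (length ∘ ball)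
                          (length-mono-≤ ∘ ball⊆ball-suc) (λ k → length-filter (within? k) xs)
    = map′ (within⇒star k) (closed⇒within k (plateau⇒closed k eq) (within-start k)) (within? k b)

other : Colour → Colour
other red = blue
other blue = red

_≟ᶜ_ : DecidableEquality Colour
red ≟ᶜ red = yes refl
red ≟ᶜ blue = no λ ()
blue ≟ᶜ red = no λ ()
blue ≟ᶜ blue = yes refl

colour-dichotomy : ∀ x c → x ≡ c ⊎ x ≡ other c
colour-dichotomy red red = inj₁ refl
colour-dichotomy red blue = inj₂ refl
colour-dichotomy blue red = inj₂ refl
colour-dichotomy blue blue = inj₁ refl

≢other : ∀ {c} → c ≢ other c
≢other {red} ()
≢other {blue} ()

module _ {n : ℕ} (χ : Colouring n) where

  reach-lr : ∀ {c i j} → χ i j ≡ c → Reach χ c (inj₁ i) (inj₂ j)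
  reach-lr e = lr e ◅ ε

  reach-rl : ∀ {c i j} → χ i j ≡ c → Reach χ c (inj₂ j) (inj₁ i)
  reach-rl e = rl e ◅ ε

  reach-sym : ∀ {c x y} → Reach χ c x y → Reach χ c y x
  reach-sym = reverse λ { (lr e) → rl e ; (rl e) → lr e }

  adj? : ∀ c → Binary.Decidable (Adj χ c)
  adj? c (inj₁ i) (inj₁ i') = no λ ()
  adj? c (inj₂ j) (inj₂ j') = no λ ()
  adj? c (inj₁ i) (inj₂ j) = map′ lr (λ { (lr e) → e }) (χ i j ≟ᶜ c)
  adj? c (inj₂ j) (inj₁ i) = map′ rl (λ { (rl e) → e }) (χ i j ≟ᶜ c)

  vertices : List (Vertex n)
  vertices = map inj₁ (allFin n) ++ map inj₂ (allFin n)

  ∈-vertices : ∀ v → v ∈ vertices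
  ∈-vertices (inj₁ i) = ∈-++⁺ˡ (∈-map⁺ inj₁ (∈-allFin i))
  ∈-vertices (inj₂ j) = ∈-++⁺ʳ (map inj₁ (allFin n)) (∈-map⁺ inj₂ (∈-allFin j))

  reach? : ∀ c x y → Dec (Reach χ c x y)
  reach? c = FiniteReachability.star? (≡-dec _≟_ _≟_) ∈-vertices (adj? c)

  -- If the c-component of z misses v, all edges from it to v have the other colour.
  reach-via-missed : ∀ c {z v} → ¬ Reach χ c (inj₁ z) (inj₂ v) →
    ∀ {w} → Reach χ c (inj₁ z) (inj₁ w) → Reach χ (other c) (inj₁ z) (inj₁ w)
  reach-via-missed c {z} {v} z↛v {w} z→w
    with colour-dichotomy (χ z v) c | colour-dichotomy (χ w v) c
  ... | inj₁ zv | _ = contradiction (reach-lr zv) z↛v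
  ... | inj₂ _ | inj₁ wv = contradiction (z→w ◅◅ reach-lr wv) z↛v
  ... | inj₂ zv | inj₂ wv = reach-lr zv ◅◅ reach-rl wv

restrict : ∀ {n} → Colouring (suc n) → Colouring n
restrict χ i j = χ (suc i) (suc j)

liftᵛ : ∀ {n} → Vertex n → Vertex (suc n)
liftᵛ = Sum.map suc suc

reach-restrict : ∀ {n} (χ : Colouring (suc n)) {c x y} →
  Reach (restrict χ) c x y → Reach χ c (liftᵛ x) (liftᵛ y)
reach-restrict χ = gmap liftᵛ λ { (lr e) → lr e ; (rl e) → rl e }

-- Perfect matchings given by permutations

permutation-injective : ∀ {n} (π : Permutation′ n) {i i'} → π ⟨$⟩ʳ i ≡ π ⟨$⟩ʳ i' → i ≡ i'
permutation-injective π eq = trans (sym (inverseˡ π)) (trans (cong (π ⟨$⟩ˡ_) eq) (inverseˡ π))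

transpose-matchʳ : ∀ {n} (i j : Fin n) → PC.transpose i j j ≡ i
transpose-matchʳ i j with j ≟ i
... | yes refl = refl
... | no _ rewrite dec-true (j ≟ j) refl = refl

transpose-fixes : ∀ {n} {i j k : Fin n} → k ≢ i → k ≢ j → PC.transpose i j k ≡ k
transpose-fixes {i = i} {j} {k} k≢i k≢j
  rewrite dec-false (k ≟ i) k≢i | dec-false (k ≟ j) k≢j = refl

module _ {n : ℕ} (π : Permutation′ n) where

  edgesOf : {P : Pred (Fin n) 0ℓ} → Decidable P → List (Edge n)
  edgesOf P? = map (λ i → i , π ⟨$⟩ʳ i) (filter P? (allFin n))

  partner : Vertex n → Fin n
  partner (inj₁ i) = i
  partner (inj₂ j) = π ⟨$⟩ˡ j

  module _ {P : Pred (Fin n) 0ℓ} (P? : Decidable P) where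

    edgesOf-isMatching : IsMatching (edgesOf P?)
    edgesOf-isMatching =
        subst Unique (map-∘ _) (Unique-map⁺ id distinct)
      , subst Unique (map-∘ _) (Unique-map⁺ (permutation-injective π) distinct)
      where
      distinct : Unique (filter P? (allFin n))
      distinct = Unique-filter⁺ P? (allFin⁺ n)

    ∈-edgesOf⁺ : ∀ {i} → P i → (i , π ⟨$⟩ʳ i) ∈ edgesOf P?
    ∈-edgesOf⁺ {i} p = ∈-map⁺ _ (∈-filter⁺ P? (∈-allFin i) p)

    ∈-edgesOf⁻ : ∀ {e} → e ∈ edgesOf P? → P (proj₁ e) × proj₂ e ≡ π ⟨$⟩ʳ proj₁ e
    ∈-edgesOf⁻ m with i , i∈ , refl ← ∈-map⁻ _ m = proj₂ (∈-filter⁻ P? {xs = allFin n} i∈) , refl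

    InV-edgesOf⁺ : ∀ {v} → P (partner v) → InV (edgesOf P?) v
    InV-edgesOf⁺ {inj₁ i} p = π ⟨$⟩ʳ i , ∈-edgesOf⁺ p
    InV-edgesOf⁺ {inj₂ j} p =
      π ⟨$⟩ˡ j , subst (λ k → (π ⟨$⟩ˡ j , k) ∈ edgesOf P?) (inverseʳ π) (∈-edgesOf⁺ p)

    InV-edgesOf⁻ : ∀ {v} → InV (edgesOf P?) v → P (partner v)
    InV-edgesOf⁻ {inj₁ i} (_ , m) = proj₁ (∈-edgesOf⁻ m)
    InV-edgesOf⁻ {inj₂ j} (i , m) with p , refl ← ∈-edgesOf⁻ m = subst P (sym (inverseˡ π)) p

  edgesOf-disjoint : {P Q : Pred (Fin n) 0ℓ} (P? : Decidable P) (Q? : Decidable Q) →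
    (∀ {i} → P i → Q i → ⊥) → VDisjoint (edgesOf P?) (edgesOf Q?)
  edgesOf-disjoint P? Q? P∩Q=∅ v p q = P∩Q=∅ (InV-edgesOf⁻ P? p) (InV-edgesOf⁻ Q? q)

  module _ (χ : Colouring n) where

    MatchedIn : Colour → Pred (Fin n) 0ℓ
    MatchedIn c i = χ i (π ⟨$⟩ʳ i) ≡ c

    matchedIn? : ∀ c → Decidable (MatchedIn c)
    matchedIn? c i = χ i (π ⟨$⟩ʳ i) ≟ᶜ c

    EdgesConnected : Colour → Set
    EdgesConnected c =
      ∀ {i i'} → MatchedIn c i → MatchedIn c i' → Reach χ c (inj₁ i) (inj₁ i')

    edgesOf-monoConn : ∀ c {P : Pred (Fin n) 0ℓ} (P? : Decidable P) →
      (∀ {i} → P i → MatchedIn c i) →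
      (∀ {i i'} → P i → P i' → Reach χ c (inj₁ i) (inj₁ i')) →
      MonoConnMatching χ c (edgesOf P?)
    edgesOf-monoConn c {P} P? P⇒c P-connected =
        edgesOf-isMatching P?
      , tabulate (λ m → colour (∈-edgesOf⁻ P? m))
      , λ m m' → P-connected (proj₁ (∈-edgesOf⁻ P? m)) (proj₁ (∈-edgesOf⁻ P? m'))
      where
      colour : ∀ {e} → P (proj₁ e) × proj₂ e ≡ π ⟨$⟩ʳ proj₁ e → χ (proj₁ e) (proj₂ e) ≡ c
      colour (p , refl) = P⇒c p

    connected-anchored : ∀ c {a} → (∀ {i} → MatchedIn c i → Reach χ c (inj₁ i) a) →
                         EdgesConnected c
    connected-anchored c anchor p p' = anchor p ◅◅ reach-sym χ (anchor p')

    connected-if-component⊇right : ∀ c {a} → (∀ j → Reach χ c a (inj₂ j)) → EdgesConnected c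
    connected-if-component⊇right c ⊇R =
      connected-anchored c λ {i} p → reach-lr χ p ◅◅ reach-sym χ (⊇R (π ⟨$⟩ʳ i))

    connected-if-component⊇left : ∀ c {a} → (∀ i → Reach χ c a (inj₁ i)) → EdgesConnected c
    connected-if-component⊇left c ⊇L = connected-anchored c λ {i} _ → reach-sym χ (⊇L i)

    span2 : EdgesConnected red → EdgesConnected blue → Span2 χ red blue
    span2 red-conn blue-conn =
        edgesOf (matchedIn? red) , edgesOf (matchedIn? blue)
      , edgesOf-monoConn red (matchedIn? red) id red-conn
      , edgesOf-monoConn blue (matchedIn? blue) id blue-conn
      , edgesOf-disjoint (matchedIn? red) (matchedIn? blue) (λ r b → ≢other (trans (sym r) b))
      , λ v → Sum.map (InV-edgesOf⁺ (matchedIn? red)) (InV-edgesOf⁺ (matchedIn? blue))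
                      (colour-dichotomy (χ (partner v) (π ⟨$⟩ʳ partner v)) red)

    module _ (c : Colour) (label : Fin n → Bool) where

      Labelled : Bool → Pred (Fin n) 0ℓ
      Labelled b i = MatchedIn (other c) i × label i ≡ b

      labelled? : ∀ b → Decidable (Labelled b)
      labelled? b i = matchedIn? (other c) i ×-dec (label i Bool.≟ b)

      span3 : EdgesConnected c →
        (∀ {b} {i i'} → Labelled b i → Labelled b i' → Reach χ (other c) (inj₁ i) (inj₁ i')) →
        Span3 χ c (other c)
      span3 c-conn labelled-conn =
          edgesOf (matchedIn? c) , edgesOf (labelled? true) , edgesOf (labelled? false)
        , edgesOf-monoConn c (matchedIn? c) id c-conn
        , edgesOf-monoConn (other c) (labelled? true) proj₁ labelled-conn
        , edgesOf-monoConn (other c) (labelled? false) proj₁ labelled-conn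
        , edgesOf-disjoint (matchedIn? c) (labelled? true) c∩other=∅
        , edgesOf-disjoint (matchedIn? c) (labelled? false) c∩other=∅
        , edgesOf-disjoint (labelled? true) (labelled? false) true∩false=∅
        , cover
        where
        true∩false=∅ : ∀ {i} → Labelled true i → Labelled false i → ⊥
        true∩false=∅ (_ , t) (_ , f) with () ← trans (sym t) f
        c∩other=∅ : ∀ {b i} → MatchedIn c i → Labelled b i → ⊥
        c∩other=∅ p (q , _) = ≢other (trans (sym p) q)
        cover : ∀ v → InV (edgesOf (matchedIn? c)) v
                    ⊎ InV (edgesOf (labelled? true)) v ⊎ InV (edgesOf (labelled? false)) v
        cover v with colour-dichotomy (χ (partner v) (π ⟨$⟩ʳ partner v)) c | label (partner v) in eq
        ... | inj₁ p | _ = inj₁ (InV-edgesOf⁺ (matchedIn? c) p)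
        ... | inj₂ q | true = inj₂ (inj₁ (InV-edgesOf⁺ (labelled? true) (q , eq)))
        ... | inj₂ q | false = inj₂ (inj₂ (InV-edgesOf⁺ (labelled? false) (q , eq)))

-- A perfect matching whose edges of a prescribed colour are connected

connected-lift : ∀ {n} (χ : Colouring (suc n)) {d}
  (π : Permutation′ n) (ρ : Permutation′ (suc n)) →
  (∀ {i} → MatchedIn ρ χ d i → ∃ λ k → i ≡ suc k × MatchedIn π (restrict χ) d k) →
  EdgesConnected π (restrict χ) d → EdgesConnected ρ χ d
connected-lift χ π ρ lifts conn p p' with lifts p | lifts p'
... | k , refl , q | k' , refl , q' = reach-restrict χ (conn q q')

module ExtendMatching {n : ℕ} (χ : Colouring (suc n)) (d : Colour)
  (π : Permutation′ n) (conn : EdgesConnected π (restrict χ) d) where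

  lift₀-lifts : χ zero zero ≢ d →
    ∀ {i} → MatchedIn (lift₀ π) χ d i → ∃ λ k → i ≡ suc k × MatchedIn π (restrict χ) d k
  lift₀-lifts 00≢d {zero} p = contradiction p 00≢d
  lift₀-lifts 00≢d {suc k} p = k , refl , p

  module _ {s : Fin n} (s-matched : MatchedIn π (restrict χ) d s) where

    t : Fin n
    t = π ⟨$⟩ʳ s

    -- ρ sends 0 to suc t and suc s to 0, and agrees with lift₀ π elsewhere.
    ρ : Permutation′ (suc n)
    ρ = lift₀ π ∘ₚ transpose zero (suc t)

    ρ-lifts : χ zero (suc t) ≢ d → χ (suc s) zero ≢ d →
      ∀ {i} → MatchedIn ρ χ d i → ∃ λ k → i ≡ suc k × MatchedIn π (restrict χ) d k
    ρ-lifts 0t≢d _ {zero} p = contradiction p 0t≢d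
    ρ-lifts _ s0≢d {suc k} p with k ≟ s
    ... | yes refl =
      contradiction (subst (λ j → χ (suc s) j ≡ d) (transpose-matchʳ zero (suc t)) p) s0≢d
    ... | no k≢s =
      k , refl , subst (λ j → χ (suc k) j ≡ d) (transpose-fixes {i = zero} (λ ()) πk≢t) p
      where
      πk≢t : suc (π ⟨$⟩ʳ k) ≢ suc t
      πk≢t eq = k≢s (permutation-injective π (suc-injective eq))

    lift₀-anchored : ∀ {x} → Reach χ d (inj₁ zero) x → Reach χ d x (inj₁ (suc s)) →
      ∀ {i} → MatchedIn (lift₀ π) χ d i → Reach χ d (inj₁ i) (inj₁ (suc s))
    lift₀-anchored 0→x x→s {zero} _ = 0→x ◅◅ x→s
    lift₀-anchored _ _ {suc k} p = reach-restrict χ (conn p s-matched)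

  extend : Σ (Permutation′ (suc n)) λ ρ → EdgesConnected ρ χ d
  extend with χ zero zero ≟ᶜ d | any? (matchedIn? π (restrict χ) d)
  ... | no 00≢d | _ = lift₀ π , connected-lift χ π (lift₀ π) (lift₀-lifts 00≢d) conn
  ... | yes 00≡d | no none = lift₀ π , connected-anchored (lift₀ π) χ d only-zero
    where
    only-zero : ∀ {i} → MatchedIn (lift₀ π) χ d i → Reach χ d (inj₁ i) (inj₁ zero)
    only-zero {zero} _ = ε
    only-zero {suc k} p = contradiction (k , p) none
  ... | yes 00≡d | yes (s , s-matched)
    with χ zero (suc (π ⟨$⟩ʳ s)) ≟ᶜ d | χ (suc s) zero ≟ᶜ d
  ...   | yes 0t | _ = lift₀ π , connected-anchored (lift₀ π) χ d
                         (lift₀-anchored s-matched (reach-lr χ 0t) (reach-rl χ s-matched))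
  ...   | no _ | yes s0 = lift₀ π , connected-anchored (lift₀ π) χ d
                         (lift₀-anchored s-matched (reach-lr χ 00≡d) (reach-rl χ s0))
  ...   | no 0t≢d | no s0≢d =
    ρ s-matched , connected-lift χ π (ρ s-matched) (ρ-lifts s-matched 0t≢d s0≢d) conn

connectedMatching : ∀ {n} (χ : Colouring n) d → Σ (Permutation′ n) λ π → EdgesConnected π χ d
connectedMatching {zero} χ d = idₚ , λ {i} → ⊥-elim (¬Fin0 i)
connectedMatching {suc n} χ d with π , conn ← connectedMatching (restrict χ) d =
  ExtendMatching.extend χ d π conn

-- Split colourings

-- The two values of the labels index the two c-components.
record TwoBlocks {n : ℕ} (χ : Colouring n) (c : Colour) : Set where
  field
    left right : Fin n → Bool
    sameBlock⇒ : ∀ {i j} → χ i j ≡ c → left i ≡ right j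
    sameBlock⇐ : ∀ {i j} → left i ≡ right j → χ i j ≡ c
    left-onto : ∀ b → ∃ λ i → left i ≡ b
    right-onto : ∀ b → ∃ λ j → right j ≡ b

module _ {n : ℕ} {χ : Colouring n} {c : Colour} (T : TwoBlocks χ c) where
  open TwoBlocks T

  block : Vertex n → Bool
  block (inj₁ i) = left i
  block (inj₂ j) = right j

  reach⇒sameBlock : ∀ {x y} → Reach χ c x y → block x ≡ block y
  reach⇒sameBlock ε = refl
  reach⇒sameBlock (lr e ◅ p) = trans (sameBlock⇒ e) (reach⇒sameBlock p)
  reach⇒sameBlock (rl e ◅ p) = trans (sym (sameBlock⇒ e)) (reach⇒sameBlock p)

  sameBlock⇒reach : ∀ x y → block x ≡ block y → Reach χ c x y
  sameBlock⇒reach (inj₁ i) (inj₁ i') eq with j , rj ← right-onto (left i) =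
    reach-lr χ (sameBlock⇐ (sym rj)) ◅◅ reach-rl χ (sameBlock⇐ (trans (sym eq) (sym rj)))
  sameBlock⇒reach (inj₁ i) (inj₂ j) eq = reach-lr χ (sameBlock⇐ eq)
  sameBlock⇒reach (inj₂ j) (inj₁ i) eq = reach-rl χ (sameBlock⇐ (sym eq))
  sameBlock⇒reach (inj₂ j) (inj₂ j') eq with i , li ← left-onto (right j) =
    reach-rl χ (sameBlock⇐ li) ◅◅ reach-lr χ (sameBlock⇐ (trans li eq))

  nonTrivialComp : ∀ w → NonTrivialComp χ c w
  nonTrivialComp w with i , li ← left-onto (block w) | j , rj ← right-onto (block w) =
    (i , sameBlock⇒reach w (inj₁ i) (sym li)) , (j , sameBlock⇒reach w (inj₂ j) (sym rj))

  exactlyTwoComps : ExactlyTwoComps χ c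
  exactlyTwoComps with i₁ , l₁ ← left-onto true | i₀ , l₀ ← left-onto false =
    inj₁ i₁ , inj₁ i₀ , separated , cover
    where
    separated : ¬ Reach χ c (inj₁ i₁) (inj₁ i₀)
    separated p with () ← trans (sym l₁) (trans (reach⇒sameBlock p) l₀)
    cover : ∀ w → Reach χ c (inj₁ i₁) w ⊎ Reach χ c (inj₁ i₀) w
    cover w with block w in eq
    ... | true = inj₁ (sameBlock⇒reach (inj₁ i₁) w (trans l₁ (sym eq)))
    ... | false = inj₂ (sameBlock⇒reach (inj₁ i₀) w (trans l₀ (sym eq)))

  otherColour-sameLeft : ∀ {i i' j} → left i ≡ left i' → χ i j ≡ other c → χ i' j ≡ other c
  otherColour-sameLeft {i} {i'} {j} eq ij with colour-dichotomy (χ i' j) c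
  ... | inj₁ i'j = contradiction (trans (sym (sameBlock⇐ (trans eq (sameBlock⇒ i'j)))) ij) ≢other
  ... | inj₂ i'j = i'j

  twoBlocks-other : TwoBlocks χ (other c)
  twoBlocks-other = record
    { left = left
    ; right = not ∘ right
    ; sameBlock⇒ = λ ij → ¬-not λ eq → ≢other (trans (sym (sameBlock⇐ eq)) ij)
    ; sameBlock⇐ = λ {i} {j} eq →
        Sum.[ (λ ij → contradiction eq (not-¬ (sameBlock⇒ ij))) , id ]′ (colour-dichotomy (χ i j) c)
    ; left-onto = left-onto
    ; right-onto = λ b → map₂ (λ rj → trans (cong not rj) (not-involutive b)) (right-onto (not b))
    }

  -- The other-colour edges of the matching split by the label of their left end.
  span3ᵀ : Span3 χ c (other c)
  span3ᵀ with π , conn ← connectedMatching χ c =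
    span3 π χ c left conn λ {_} {i} (ii , li) (_ , li') →
      reach-lr χ ii ◅◅ reach-rl χ (otherColour-sameLeft (trans li (sym li')) ii)

twoBlocks-all : ∀ {n} {χ : Colouring n} → TwoBlocks χ red → ∀ c → TwoBlocks χ c
twoBlocks-all T red = T
twoBlocks-all T blue = twoBlocks-other T

twoBlocks⇒split : ∀ {n} {χ : Colouring n} → TwoBlocks χ red → Split χ
twoBlocks⇒split T =
  (λ c → nonTrivialComp (twoBlocks-all T c)) , (λ c → exactlyTwoComps (twoBlocks-all T c))

span2-if-component⊇right : ∀ {n} (χ : Colouring n) c {a} → (∀ j → Reach χ c a (inj₂ j)) →
                           Span2 χ red blue
span2-if-component⊇right χ red ⊇R with π , conn ← connectedMatching χ blue =
  span2 π χ (connected-if-component⊇right π χ red ⊇R) conn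
span2-if-component⊇right χ blue ⊇R with π , conn ← connectedMatching χ red =
  span2 π χ conn (connected-if-component⊇right π χ blue ⊇R)

-- The red and the blue component of u = inj₁ zero have the same left part R,
-- and a blue edge inside R, or inside its complement, would enlarge R.
module InducedTwoBlocks {m : ℕ} (χ : Colouring (suc m)) {v₁ v₂ w₀ : Fin (suc m)}
  (v₁∉R : ¬ Reach χ red (inj₁ zero) (inj₂ v₁))
  (v₂∉B : ¬ Reach χ blue (inj₁ zero) (inj₂ v₂))
  (w₀∉R : ¬ Reach χ red (inj₁ zero) (inj₁ w₀)) where

  R : Vertex (suc m) → Set
  R = Reach χ red (inj₁ zero)

  R⇒B : ∀ {w} → R (inj₁ w) → Reach χ blue (inj₁ zero) (inj₁ w)
  R⇒B = reach-via-missed χ red v₁∉R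

  B⇒R : ∀ {w} → Reach χ blue (inj₁ zero) (inj₁ w) → R (inj₁ w)
  B⇒R = reach-via-missed χ blue v₂∉B

  no-blue-inside : ∀ {i j} → χ i j ≡ blue → R (inj₁ i) → R (inj₂ j) → ⊥
  no-blue-inside {i} {j} ij i∈R j∈R with colour-dichotomy (χ w₀ j) red
  ... | inj₁ w₀j = w₀∉R (j∈R ◅◅ reach-rl χ w₀j)
  ... | inj₂ w₀j = w₀∉R (B⇒R (R⇒B i∈R ◅◅ reach-lr χ ij ◅◅ reach-rl χ w₀j))

  no-blue-outside : ∀ {i j} → χ i j ≡ blue → ¬ R (inj₁ i) → ¬ R (inj₂ j) → ⊥
  no-blue-outside {i} {j} ij i∉R j∉R with colour-dichotomy (χ zero j) red
  ... | inj₁ uj = j∉R (reach-lr χ uj)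
  ... | inj₂ uj = i∉R (B⇒R (reach-lr χ uj ◅◅ reach-rl χ ij))

  R? : ∀ x → Dec (R x)
  R? = reach? χ red (inj₁ zero)

  red-if-both-or-neither : ∀ {i j} →
    (R (inj₁ i) × R (inj₂ j)) ⊎ (¬ R (inj₁ i) × ¬ R (inj₂ j)) → χ i j ≡ red
  red-if-both-or-neither {i} {j} both-or-neither
    with colour-dichotomy (χ i j) red | both-or-neither
  ... | inj₁ ij | _ = ij
  ... | inj₂ ij | inj₁ (i∈R , j∈R) = ⊥-elim (no-blue-inside ij i∈R j∈R)
  ... | inj₂ ij | inj₂ (i∉R , j∉R) = ⊥-elim (no-blue-outside ij i∉R j∉R)

  twoBlocks : TwoBlocks χ red
  twoBlocks = record
    { left = does ∘ R? ∘ inj₁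
    ; right = does ∘ R? ∘ inj₂
    ; sameBlock⇒ = λ {i} {j} ij →
        does-⇔ (mk⇔ (_◅◅ reach-lr χ ij) (_◅◅ reach-rl χ ij)) (R? (inj₁ i)) (R? (inj₂ j))
    ; sameBlock⇐ = λ {i} {j} eq →
        red-if-both-or-neither (does-≡⇒both-or-neither (R? (inj₁ i)) (R? (inj₂ j)) eq)
    ; left-onto = λ { true → zero , dec-true (R? (inj₁ zero)) ε
                    ; false → w₀ , dec-false (R? (inj₁ w₀)) w₀∉R }
    ; right-onto = λ { true → v₂ , dec-true (R? (inj₂ v₂)) v₂∈R
                     ; false → v₁ , dec-false (R? (inj₂ v₁)) v₁∉R }
    }
    where
    v₂∈R : R (inj₂ v₂)
    v₂∈R with colour-dichotomy (χ zero v₂) red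
    ... | inj₁ uv₂ = reach-lr χ uv₂
    ... | inj₂ uv₂ = contradiction (reach-lr χ uv₂) v₂∉B

-- Decisions of reachability are consumed by helper functions rather than
-- 'with': abstracting over them makes the type checker evaluate the search.
span2-or-twoBlocks : ∀ {m} (χ : Colouring (suc m)) → Span2 χ red blue ⊎ TwoBlocks χ red
span2-or-twoBlocks {m} χ =
  cases (∀-or-∃¬ (λ j → reach? χ red u (inj₂ j))) (∀-or-∃¬ (λ j → reach? χ blue u (inj₂ j)))
  where
  u : Vertex (suc m)
  u = inj₁ zero
  cases : (∀ j → Reach χ red u (inj₂ j)) ⊎ (∃ λ j → ¬ Reach χ red u (inj₂ j)) →
          (∀ j → Reach χ blue u (inj₂ j)) ⊎ (∃ λ j → ¬ Reach χ blue u (inj₂ j)) →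
          Span2 χ red blue ⊎ TwoBlocks χ red
  cases (inj₁ ⊇R) _ = inj₁ (span2-if-component⊇right χ red ⊇R)
  cases _ (inj₁ ⊇B) = inj₁ (span2-if-component⊇right χ blue ⊇B)
  cases (inj₂ (v₁ , v₁∉R)) (inj₂ (v₂ , v₂∉B)) =
    Sum.map span2-if-⊇L (λ (_ , w₀∉R) → InducedTwoBlocks.twoBlocks χ v₁∉R v₂∉B w₀∉R)
            (∀-or-∃¬ (λ i → reach? χ red u (inj₁ i)))
    where
    span2-if-⊇L : (∀ i → Reach χ red u (inj₁ i)) → Span2 χ red blue
    span2-if-⊇L ⊇L = span2 idₚ χ (connected-if-component⊇left idₚ χ red ⊇L)
      (connected-if-component⊇left idₚ χ blue (reach-via-missed χ red v₁∉R ∘ ⊇L))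

lemma6 : (n : ℕ) (χ : Colouring n) →
    Span2 χ red blue
    ⊎ (Split χ × Span3 χ red blue × Span3 χ blue red)
lemma6 zero χ = inj₁ (span2 idₚ χ (λ {i} → ⊥-elim (¬Fin0 i)) (λ {i} → ⊥-elim (¬Fin0 i)))
lemma6 (suc m) χ = Sum.map₂ split-cases (span2-or-twoBlocks χ)
  where
  split-cases : TwoBlocks χ red → Split χ × Span3 χ red blue × Span3 χ blue red
  split-cases T =
    twoBlocks⇒split T , span3ᵀ (twoBlocks-all T red) , span3ᵀ (twoBlocks-all T blue)
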